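{- Let $G=(K,I;E)$ be a split graph, $c\ge1$ and $k\ge0$ integers. If $S$ and $S'$ are $c$-colorable sets of $G$ with $|S|\ge k$ and $|S'|\ge k$, then there is a $\mathsf{TAR}_k$-sequence between $S$ and $S'$ if and only if there is a $\mathsf{TAR}_k$-sequence between $T_{S\cap K}$ and $T_{S'\cap K}$.
   Context: A split graph $G=(K,I;E)$ has vertex set partitioned into a clique $K$ and an independent set $I$. A set $S\subseteq V(G)$ is $c$-colorable if $G[S]$ has a proper $c$-coloring. For $C \subseteq K$ with $|C|\le c$, define $T_C = C \cup I$ if $|C|<c$, and $T_C = (C\cup I)\setminus\{u \in I : C \subseteq N_G(u)\}$ if $|C|=c$, where $N_G(u)$ is the neighborhood of $u$. For $c$-colorable sets $S,T$, $S \leftrightarrow T$ under $\mathsf{TAR}_k$ means $|S|,|T|\ge k$ and $|S\triangle T|=1$; a $\mathsf{TAR}_k$-sequence between $S_0$ and $S_\ell$ is a sequence $\langle S_0,\dots,S_\ell\rangle$ of $c$-colorable sets with $S_{i-1}\leftrightarrow S_i$ under $\mathsf{TAR}_k$ for all $i$. -}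

module Defs where

open import Data.Bool using (Bool; true; false; _∧_; if_then_else_)
open import Data.Nat using (ℕ; _≤_; _<_; _<ᵇ_)
open import Data.Fin using (Fin)
open import Data.Fin.Subset using (Subset; _∈_; _⊆_; ∁; _∩_; _∪_; _─_; ∣_∣; inside; outside)
open import Data.Fin.Subset.Properties using (_⊆?_; _∈?_)
open import Data.Vec using (tabulate)
open import Data.Product using (Σ; _×_)
open import Relation.Nullary using (¬_)
open import Relation.Nullary.Decidable using (⌊_⌋)
open import Relation.Binary.PropositionalEquality using (_≡_; _≢_)

record SplitGraph (n : ℕ) : Set where
  field
    adj     : Fin n → Fin n → Bool
    sym     : ∀ u v → adj u v ≡ adj v u
    irrefl  : ∀ u → adj u u ≡ false
    K       : Subset n
    clique  : ∀ u v → u ∈ K → v ∈ K → u ≢ v → adj u v ≡ true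
    indep   : ∀ u v → u ∈ ∁ K → v ∈ ∁ K → adj u v ≡ false

  I : Subset n
  I = ∁ K

  N : Fin n → Subset n
  N u = tabulate (adj u)

module _ {n : ℕ} (G : SplitGraph n) where
  open SplitGraph G

  Colorable : ℕ → Subset n → Set
  Colorable c S = Σ (Fin n → Fin c) λ f →
    ∀ u v → u ∈ S → v ∈ S → adj u v ≡ true → f u ≢ f v

  _△_ : Subset n → Subset n → Subset n
  S △ T = (S ─ T) ∪ (T ─ S)

  TARStep : ℕ → ℕ → Subset n → Subset n → Set
  TARStep c k S T = Colorable c S × Colorable c T
                  × k ≤ ∣ S ∣ × k ≤ ∣ T ∣ × ∣ S △ T ∣ ≡ 1

  data TARSeq (c k : ℕ) : Subset n → Subset n → Set where
    [_] : ∀ {S} → Colorable c S → TARSeq c k S S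
    _∷_ : ∀ {S T U} → TARStep c k S T → TARSeq c k T U → TARSeq c k S U

  -- T_C for C ⊆ K (only meaningful for |C| ≤ c):
  --   C ∪ I                                    if |C| < c
  --   (C ∪ I) ∖ {u ∈ I : C ⊆ N_G(u)}            otherwise (i.e. |C| = c)
  T : ℕ → Subset n → Subset n
  T c C = if ∣ C ∣ <ᵇ c then C ∪ I
          else (C ∪ I) ─ tabulate (λ u → ⌊ u ∈? I ⌋ ∧ ⌊ C ⊆? N u ⌋)

module Submission where

-- TAR_k-reachability is an equivalence relation, and every
-- c-colorable S with |S| ≥ k reaches T_{S∩K}, because T_{S∩K} is a
-- c-colorable superset of S whose surplus vertices can be removed one at a
-- time.  With C = S ∩ K: if |C| < c the vertices of I share a color unused on
-- C; if |C| = c, each vertex of I left in T_C has a non-neighbour in C and takes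
-- its color.  A vertex of S ∩ I adjacent to all of C cannot exist then, as it
-- would complete a clique of size c + 1 inside S.

open import Defs
open import Data.Nat using (ℕ; _≤_)
open import Data.Fin.Subset using (Subset; _∩_; ∣_∣)
open import Data.Product using (_×_)
open import Function.Bundles using (_⇔_)

open import Data.Bool as Bool using (Bool; true; false; _∧_)
open import Data.Bool.Properties using (T-≡; T-∧)
open import Data.Empty using (⊥-elim)
open import Data.Fin using (Fin; zero; suc)
open import Data.Fin.Properties as Fin using (any?; all?; ¬∀⟶∃¬; suc-injective; 0≢1+n)
open import Data.Fin.Subset using (_∈_; _∉_; _⊆_; _⊂_; ∁; _∪_; _─_; _-_; ⁅_⁆; ⊤; ⊥; inside; outside)
open import Data.Fin.Subset.Properties
open import Data.Nat using (_<_; _<ᵇ_; z≤n; s≤s)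
open import Data.Nat.Induction using (<-wellFounded)
open import Data.Nat.Properties using (≤-trans; <-≤-trans; <⇒≱; <ᵇ⇒<; <⇒<ᵇ)
open import Data.Product using (∃; _,_; proj₁; proj₂)
open import Data.Sum using (_⊎_; inj₁; inj₂)
open import Data.Vec using ([]; _∷_; tabulate; here; there)
open import Data.Vec.Properties using ([]=⇒lookup; lookup⇒[]=; lookup∘tabulate)
open import Function using (_∘_)
open import Function.Bundles using (mk⇔; Equivalence)
open import Induction.WellFounded using (Acc; acc)
open import Relation.Nullary using (¬_; Dec; yes; no; ¬?)
open import Relation.Nullary.Decidable using (⌊_⌋; _×-dec_; toWitness; fromWitness)
open import Relation.Binary.PropositionalEquality using (_≡_; _≢_; refl; sym; trans; cong; subst; module ≡-Reasoning)

∈tabulate⁻ : ∀ {m} {h : Fin m → Bool} {x} → x ∈ tabulate h → h x ≡ true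
∈tabulate⁻ {h = h} {x} x∈ = trans (sym (lookup∘tabulate h x)) ([]=⇒lookup x∈)

∈tabulate⁺ : ∀ {m} {h : Fin m → Bool} {x} → h x ≡ true → x ∈ tabulate h
∈tabulate⁺ {h = h} {x} hx = lookup⇒[]= x _ (trans (lookup∘tabulate h x) hx)

x∈p∪q∧x∉p⇒x∈q : ∀ {m} {p q : Subset m} {x} → x ∈ p ∪ q → x ∉ p → x ∈ q
x∈p∪q∧x∉p⇒x∈q {p = p} {q} x∈p∪q x∉p with x∈p∪q⁻ p q x∈p∪q
... | inj₁ x∈p = ⊥-elim (x∉p x∈p)
... | inj₂ x∈q = x∈q

x∈p─q⇒x∉q : ∀ {m} (p q : Subset m) {x} → x ∈ p ─ q → x ∉ q
x∈p─q⇒x∉q (_ ∷ p) (outside ∷ q) here        ()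
x∈p─q⇒x∉q (_ ∷ p) (_       ∷ q) (there x∈) (there x∈q) = x∈p─q⇒x∉q p q x∈ x∈q

p─p≡⊥ : ∀ {m} (p : Subset m) → p ─ p ≡ ⊥
p─p≡⊥ []            = refl
p─p≡⊥ (inside ∷ p)  = cong (outside ∷_) (p─p≡⊥ p)
p─p≡⊥ (outside ∷ p) = cong (outside ∷_) (p─p≡⊥ p)

[p─[p-x]]∪[[p-x]─p]≡⁅x⁆ : ∀ {m} (p : Subset m) {x} → x ∈ p →
  (p ─ (p - x)) ∪ ((p - x) ─ p) ≡ ⁅ x ⁆
[p─[p-x]]∪[[p-x]─p]≡⁅x⁆ (inside ∷ p) here = cong (inside ∷_) (begin
  (p ─ (p ─ ⊥)) ∪ ((p ─ ⊥) ─ p) ≡⟨ cong (λ q → (p ─ q) ∪ (q ─ p)) (p─⊥≡p p) ⟩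
  (p ─ p) ∪ (p ─ p)             ≡⟨ ∪-idem (p ─ p) ⟩
  p ─ p                         ≡⟨ p─p≡⊥ p ⟩
  ⊥                             ∎)
  where open ≡-Reasoning
[p─[p-x]]∪[[p-x]─p]≡⁅x⁆ (inside ∷ p) (there x∈p) =
  cong (outside ∷_) ([p─[p-x]]∪[[p-x]─p]≡⁅x⁆ p x∈p)
[p─[p-x]]∪[[p-x]─p]≡⁅x⁆ (outside ∷ p) (there x∈p) =
  cong (outside ∷_) ([p─[p-x]]∪[[p-x]─p]≡⁅x⁆ p x∈p)

⊆⊎∃∉ : ∀ {m} (p q : Subset m) → p ⊆ q ⊎ ∃ λ x → x ∈ p × x ∉ q
⊆⊎∃∉ p q with any? (λ x → (x ∈? p) ×-dec ¬? (x ∈? q))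
... | yes witness = inj₂ witness
... | no ¬witness = inj₁ p⊆q
  where
  p⊆q : p ⊆ q
  p⊆q {x} x∈p with x ∈? q
  ... | yes x∈q = x∈q
  ... | no x∉q  = ⊥-elim (¬witness (x , x∈p , x∉q))

injective⇒∣p∣≤∣q∣ : ∀ {m c} (p : Subset m) (q : Subset c) (f : Fin m → Fin c) →
  (∀ {x} → x ∈ p → f x ∈ q) →
  (∀ {x y} → x ∈ p → y ∈ p → f x ≡ f y → x ≡ y) →
  ∣ p ∣ ≤ ∣ q ∣
injective⇒∣p∣≤∣q∣ []            q f _    _   = z≤n
injective⇒∣p∣≤∣q∣ (outside ∷ p) q f into inj =
  injective⇒∣p∣≤∣q∣ p q (f ∘ suc) (into ∘ there)
    (λ x∈p y∈p → suc-injective ∘ inj (there x∈p) (there y∈p))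
injective⇒∣p∣≤∣q∣ (inside ∷ p)  q f into inj =
  ≤-trans (s≤s (injective⇒∣p∣≤∣q∣ p (q - f zero) (f ∘ suc) into′ inj′))
          (x∈p⇒∣p-x∣<∣p∣ (into here))
  where
  inj′ : ∀ {x y} → x ∈ p → y ∈ p → f (suc x) ≡ f (suc y) → x ≡ y
  inj′ x∈p y∈p = suc-injective ∘ inj (there x∈p) (there y∈p)
  into′ : ∀ {x} → x ∈ p → f (suc x) ∈ q - f zero
  into′ x∈p = x∈p∧x≢y⇒x∈p-y (into (there x∈p)) (0≢1+n ∘ inj here (there x∈p) ∘ sym)

hit? : ∀ {m c} (f : Fin m → Fin c) (p : Subset m) j → Dec (∃ λ x → x ∈ p × f x ≡ j)
hit? f p j = any? (λ x → (x ∈? p) ×-dec (f x Fin.≟ j))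

missing-color : ∀ {m c} (f : Fin m → Fin c) (p : Subset m) → ∣ p ∣ < c →
  ∃ λ j → ∀ {x} → x ∈ p → f x ≢ j
missing-color {m} {c} f p ∣p∣<c with all? (hit? f p)
... | yes allHit = ⊥-elim (<⇒≱ ∣p∣<c (subst (_≤ ∣ p ∣) (∣⊤∣≡n c) c≤∣p∣))
  where
  preimage : Fin c → Fin m
  preimage j = proj₁ (allHit j)
  c≤∣p∣ : ∣ ⊤ {c} ∣ ≤ ∣ p ∣
  c≤∣p∣ = injective⇒∣p∣≤∣q∣ ⊤ p preimage (λ {j} _ → proj₁ (proj₂ (allHit j)))
    (λ {i} {j} _ _ eq → trans (sym (proj₂ (proj₂ (allHit i))))
                              (trans (cong f eq) (proj₂ (proj₂ (allHit j)))))
... | no ¬allHit with ¬∀⟶∃¬ c _ (hit? f p) ¬allHit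
...   | j , unhit = j , λ x∈p fx≡j → unhit (_ , x∈p , fx≡j)

module _ {n : ℕ} (G : SplitGraph n) where
  open SplitGraph G renaming (sym to adj-sym)

  ProperColoring : (c : ℕ) → Subset n → (Fin n → Fin c) → Set
  ProperColoring c S f = ∀ u v → u ∈ S → v ∈ S → adj u v ≡ true → f u ≢ f v

  IsClique : Subset n → Set
  IsClique P = ∀ {u v} → u ∈ P → v ∈ P → u ≢ v → adj u v ≡ true

  edge≢non-edge : ∀ {u v} → adj u v ≡ true → adj u v ≢ false
  edge≢non-edge uv uv′ with () ← trans (sym uv) uv′

  ⊆K⇒IsClique : ∀ {P} → P ⊆ K → IsClique P
  ⊆K⇒IsClique P⊆K u∈P v∈P = clique _ _ (P⊆K u∈P) (P⊆K v∈P)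

  colorable-⊆ : ∀ {c S U} → S ⊆ U → Colorable G c U → Colorable G c S
  colorable-⊆ S⊆U (f , proper) = f , λ u v u∈S v∈S → proper u v (S⊆U u∈S) (S⊆U v∈S)

  proper⇒injectiveOnClique : ∀ {c S P f} → ProperColoring c S f → P ⊆ S → IsClique P →
    ∀ {x y} → x ∈ P → y ∈ P → f x ≡ f y → x ≡ y
  proper⇒injectiveOnClique proper P⊆S isClique {x} {y} x∈P y∈P fx≡fy with x Fin.≟ y
  ... | yes x≡y = x≡y
  ... | no x≢y  = ⊥-elim (proper x y (P⊆S x∈P) (P⊆S y∈P) (isClique x∈P y∈P x≢y) fx≡fy)

  clique⊆colorable⇒∣P∣≤c : ∀ {c S P} → Colorable G c S → P ⊆ S → IsClique P → ∣ P ∣ ≤ c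
  clique⊆colorable⇒∣P∣≤c {c} {P = P} (f , proper) P⊆S isClique =
    subst (∣ P ∣ ≤_) (∣⊤∣≡n c)
      (injective⇒∣p∣≤∣q∣ P ⊤ f (λ _ → ∈⊤) (proper⇒injectiveOnClique proper P⊆S isClique))

  TARSeq-trans : ∀ {c k S U V} → TARSeq G c k S U → TARSeq G c k U V → TARSeq G c k S V
  TARSeq-trans [ _ ]        q = q
  TARSeq-trans (step ∷ p) q = step ∷ TARSeq-trans p q

  TARStep-sym : ∀ {c k S U} → TARStep G c k S U → TARStep G c k U S
  TARStep-sym {S = S} {U} (cS , cU , k≤S , k≤U , ∣S△U∣≡1) =
    cU , cS , k≤U , k≤S , trans (cong ∣_∣ (∪-comm (U ─ S) (S ─ U))) ∣S△U∣≡1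

  TARSeq-sym : ∀ {c k S U} → TARSeq G c k S U → TARSeq G c k U S
  TARSeq-sym [ cS ]       = [ cS ]
  TARSeq-sym (step ∷ p) = TARSeq-trans (TARSeq-sym p) (TARStep-sym step ∷ [ proj₁ step ])

  TARStep-remove : ∀ {c k U i} → Colorable G c U → i ∈ U → k ≤ ∣ U - i ∣ →
    TARStep G c k U (U - i)
  TARStep-remove {U = U} {i} cU i∈U k≤∣U-i∣ =
    cU , colorable-⊆ (p─q⊆p U ⁅ i ⁆) cU ,
    ≤-trans k≤∣U-i∣ (∣p─q∣≤∣p∣ U ⁅ i ⁆) , k≤∣U-i∣ ,
    trans (cong ∣_∣ ([p─[p-x]]∪[[p-x]─p]≡⁅x⁆ U i∈U)) (∣⁅x⁆∣≡1 i)

  TARSeq-⊇ : ∀ {c k S U} → S ⊆ U → Colorable G c U → k ≤ ∣ S ∣ → TARSeq G c k U S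
  TARSeq-⊇ {c} {k} {S} {U} S⊆U cU k≤∣S∣ = go U S⊆U cU (<-wellFounded ∣ U ∣)
    where
    go : ∀ U → S ⊆ U → Colorable G c U → Acc _<_ ∣ U ∣ → TARSeq G c k U S
    go U S⊆U cU (acc smaller) with ⊆⊎∃∉ U S
    ... | inj₁ U⊆S = subst (TARSeq G c k U) (⊆-antisym U⊆S S⊆U) [ cU ]
    ... | inj₂ (i , i∈U , i∉S) =
      TARStep-remove cU i∈U (≤-trans k≤∣S∣ (p⊆q⇒∣p∣≤∣q∣ S⊆U-i)) ∷
      go (U - i) S⊆U-i (colorable-⊆ (p─q⊆p U ⁅ i ⁆) cU) (smaller (x∈p⇒∣p-x∣<∣p∣ i∈U))
      where
      S⊆U-i : S ⊆ U - i
      S⊆U-i x∈S = x∈p∧x≢y⇒x∈p-y (S⊆U x∈S) (λ { refl → i∉S x∈S })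

  Blocked : Subset n → Subset n
  Blocked C = tabulate (λ u → ⌊ u ∈? I ⌋ ∧ ⌊ C ⊆? N u ⌋)

  ∈Blocked⇔ : ∀ {C u} → u ∈ Blocked C ⇔ (u ∈ I × C ⊆ N u)
  ∈Blocked⇔ {C} {u} = mk⇔ to from
    where
    to : u ∈ Blocked C → u ∈ I × C ⊆ N u
    to u∈B with Equivalence.to T-∧ (Equivalence.from T-≡ (∈tabulate⁻ u∈B))
    ... | isI , isCovered = toWitness {a? = u ∈? I} isI , toWitness {a? = C ⊆? N u} isCovered
    from : u ∈ I × C ⊆ N u → u ∈ Blocked C
    from (u∈I , C⊆Nu) = ∈tabulate⁺ (Equivalence.to T-≡ (Equivalence.from T-∧
      (fromWitness {a? = u ∈? I} u∈I , fromWitness {a? = C ⊆? N u} C⊆Nu)))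

  T-elim : ∀ c C (P : Subset n → Set) →
    (∣ C ∣ < c → P (C ∪ I)) → (¬ ∣ C ∣ < c → P ((C ∪ I) ─ Blocked C)) → P (T G c C)
  T-elim c C P small large with ∣ C ∣ <ᵇ c in eq
  ... | true  = small (<ᵇ⇒< _ c (subst Bool.T (sym eq) _))
  ... | false = large (λ lt → subst Bool.T eq (<⇒<ᵇ lt))

  colorable-∪I : ∀ {c C} → Colorable G c C → ∣ C ∣ < c → Colorable G c (C ∪ I)
  colorable-∪I {c} {C} (f , proper) ∣C∣<c = g , proper-g
    where
    spare : ∃ λ j → ∀ {x} → x ∈ C → f x ≢ j
    spare = missing-color f C ∣C∣<c
    g : Fin n → Fin c
    g u with u ∈? C
    ... | yes _ = f u
    ... | no _  = proj₁ spare
    proper-g : ProperColoring c (C ∪ I) g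
    proper-g u v u∈ v∈ uv with u ∈? C | v ∈? C
    ... | yes u∈C | yes v∈C = proper u v u∈C v∈C uv
    ... | yes u∈C | no _    = proj₂ spare u∈C
    ... | no _    | yes v∈C = proj₂ spare v∈C ∘ sym
    ... | no u∉C  | no v∉C  = λ _ → edge≢non-edge uv
          (indep u v (x∈p∪q∧x∉p⇒x∈q u∈ u∉C) (x∈p∪q∧x∉p⇒x∈q v∈ v∉C))

  -- u is colored like its representative: itself on C, a non-neighbour in C on I.
  nonNeighbour? : ∀ C u → Dec (∃ λ v → v ∈ C × adj u v ≡ false)
  nonNeighbour? C u = any? (λ v → (v ∈? C) ×-dec (adj u v Bool.≟ false))

  representative : Subset n → Fin n → Fin n
  representative C u with u ∈? C | nonNeighbour? C u
  ... | yes _ | _            = u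
  ... | no _  | yes (v , _) = v
  ... | no _  | no _         = u

  representative-spec : ∀ C u → u ∈ (C ∪ I) ─ Blocked C →
    (u ∈ C × representative C u ≡ u) ⊎
    (u ∈ I × representative C u ∈ C × adj u (representative C u) ≡ false)
  representative-spec C u u∈T with u ∈? C | nonNeighbour? C u
  ... | yes u∈C | _                    = inj₁ (u∈C , refl)
  ... | no u∉C  | yes (v , v∈C , uv) =
    inj₂ (x∈p∪q∧x∉p⇒x∈q (p─q⊆p (C ∪ I) (Blocked C) u∈T) u∉C , v∈C , uv)
  ... | no u∉C  | no ¬nonNeighbour    =
    ⊥-elim (x∈p─q⇒x∉q (C ∪ I) (Blocked C) u∈T (Equivalence.from ∈Blocked⇔
      (x∈p∪q∧x∉p⇒x∈q (p─q⊆p (C ∪ I) (Blocked C) u∈T) u∉C , C⊆Nu)))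
    where
    C⊆Nu : C ⊆ N u
    C⊆Nu {v} v∈C with adj u v in uv
    ... | true  = ∈tabulate⁺ uv
    ... | false = ⊥-elim (¬nonNeighbour (v , v∈C , uv))

  representative∈C : ∀ C u → u ∈ (C ∪ I) ─ Blocked C → representative C u ∈ C
  representative∈C C u u∈T with representative-spec C u u∈T
  ... | inj₁ (u∈C , r≡u)  = subst (_∈ C) (sym r≡u) u∈C
  ... | inj₂ (_ , r∈C , _) = r∈C

  colorable-∪I─Blocked : ∀ {c C} → C ⊆ K → Colorable G c C →
    Colorable G c ((C ∪ I) ─ Blocked C)
  colorable-∪I─Blocked {c} {C} C⊆K (f , proper) = f ∘ representative C , proper-fr
    where
    proper-fr : ProperColoring c ((C ∪ I) ─ Blocked C) (f ∘ representative C)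
    proper-fr u v u∈T v∈T uv fr≡fr
      with proper⇒injectiveOnClique proper ⊆-refl (⊆K⇒IsClique C⊆K)
             (representative∈C C u u∈T) (representative∈C C v v∈T) fr≡fr
         | representative-spec C u u∈T | representative-spec C v v∈T
    ... | ru≡rv | inj₁ (_ , ru≡u) | inj₁ (_ , rv≡v) =
      edge≢non-edge uv (trans (cong (adj u) (trans (sym rv≡v) (trans (sym ru≡rv) ru≡u))) (irrefl u))
    ... | ru≡rv | inj₁ (_ , ru≡u) | inj₂ (_ , _ , v-rv) =
      edge≢non-edge uv (trans (adj-sym u v) (trans (cong (adj v) (trans (sym ru≡u) ru≡rv)) v-rv))
    ... | ru≡rv | inj₂ (_ , _ , u-ru) | inj₁ (_ , rv≡v) =
      edge≢non-edge uv (trans (cong (adj u) (trans (sym rv≡v) (sym ru≡rv))) u-ru)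
    ... | _ | inj₂ (u∈I , _) | inj₂ (v∈I , _) = edge≢non-edge uv (indep u v u∈I v∈I)

  S⊆[S∩K]∪I : ∀ S → S ⊆ (S ∩ K) ∪ I
  S⊆[S∩K]∪I S {u} u∈S with u ∈? K
  ... | yes u∈K = x∈p∪q⁺ (inj₁ (x∈p∩q⁺ (u∈S , u∈K)))
  ... | no u∉K  = x∈p∪q⁺ (inj₂ (x∉p⇒x∈∁p u∉K))

  ∈S⇒∉Blocked[S∩K] : ∀ {c S u} → Colorable G c S → ¬ ∣ S ∩ K ∣ < c →
    u ∈ S → u ∉ Blocked (S ∩ K)
  ∈S⇒∉Blocked[S∩K] {c} {S} {u} cS ∣C∣≮c u∈S u∈B =
    ∣C∣≮c (<-≤-trans (p⊂q⇒∣p∣<∣q∣ C⊂P) (clique⊆colorable⇒∣P∣≤c cS P⊆S P-clique))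
    where
    C P : Subset n
    C = S ∩ K
    P = ⁅ u ⁆ ∪ C
    u∈I : u ∈ I
    u∈I = proj₁ (Equivalence.to ∈Blocked⇔ u∈B)
    C⊆Nu : C ⊆ N u
    C⊆Nu = proj₂ (Equivalence.to ∈Blocked⇔ u∈B)
    u∉C : u ∉ C
    u∉C u∈C = x∈∁p⇒x∉p u∈I (p∩q⊆q S K u∈C)
    C⊂P : C ⊂ P
    C⊂P = q⊆p∪q ⁅ u ⁆ C , u , x∈p∪q⁺ (inj₁ (x∈⁅x⁆ u)) , u∉C
    P⊆S : P ⊆ S
    P⊆S x∈P with x∈p∪q⁻ ⁅ u ⁆ C x∈P
    ... | inj₁ x∈⁅u⁆ = subst (_∈ S) (sym (x∈⁅y⁆⇒x≡y u x∈⁅u⁆)) u∈S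
    ... | inj₂ x∈C   = p∩q⊆p S K x∈C
    u~C : ∀ {v} → v ∈ C → adj u v ≡ true
    u~C v∈C = ∈tabulate⁻ (C⊆Nu v∈C)
    P-clique : IsClique P
    P-clique {x} {y} x∈P y∈P x≢y
      with x∈p∪q⁻ ⁅ u ⁆ C x∈P | x∈p∪q⁻ ⁅ u ⁆ C y∈P
    ... | inj₁ x∈⁅u⁆ | inj₁ y∈⁅u⁆ =
      ⊥-elim (x≢y (trans (x∈⁅y⁆⇒x≡y u x∈⁅u⁆) (sym (x∈⁅y⁆⇒x≡y u y∈⁅u⁆))))
    ... | inj₁ x∈⁅u⁆ | inj₂ y∈C = subst (λ z → adj z y ≡ true) (sym (x∈⁅y⁆⇒x≡y u x∈⁅u⁆)) (u~C y∈C)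
    ... | inj₂ x∈C | inj₁ y∈⁅u⁆ =
      subst (λ z → adj x z ≡ true) (sym (x∈⁅y⁆⇒x≡y u y∈⁅u⁆)) (trans (adj-sym x u) (u~C x∈C))
    ... | inj₂ x∈C | inj₂ y∈C = ⊆K⇒IsClique (p∩q⊆q S K) x∈C y∈C x≢y

  T-colorable-superset : ∀ {c S} → Colorable G c S →
    Colorable G c (T G c (S ∩ K)) × S ⊆ T G c (S ∩ K)
  T-colorable-superset {c} {S} cS = T-elim c C (λ X → Colorable G c X × S ⊆ X)
    (λ ∣C∣<c → colorable-∪I cC ∣C∣<c , S⊆[S∩K]∪I S)
    (λ ∣C∣≮c → colorable-∪I─Blocked (p∩q⊆q S K) cC ,
               λ u∈S → x∈p∧x∉q⇒x∈p─q (S⊆[S∩K]∪I S u∈S) (∈S⇒∉Blocked[S∩K] cS ∣C∣≮c u∈S))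
    where
    C : Subset n
    C = S ∩ K
    cC : Colorable G c C
    cC = colorable-⊆ (p∩q⊆p S K) cS

  TARSeq-T : ∀ {c k S} → Colorable G c S → k ≤ ∣ S ∣ → TARSeq G c k (T G c (S ∩ K)) S
  TARSeq-T cS k≤∣S∣ =
    TARSeq-⊇ (proj₂ (T-colorable-superset cS)) (proj₁ (T-colorable-superset cS)) k≤∣S∣

corollary18 : ∀ {n : ℕ} (G : SplitGraph n) (c k : ℕ) → 1 ≤ c →
    (S S′ : Subset n) → Colorable G c S → Colorable G c S′ →
    k ≤ ∣ S ∣ → k ≤ ∣ S′ ∣ →
    TARSeq G c k S S′ ⇔
    TARSeq G c k (T G c (S ∩ SplitGraph.K G)) (T G c (S′ ∩ SplitGraph.K G))
corollary18 {n} G c k _ S S′ cS cS′ k≤∣S∣ k≤∣S′∣ = mk⇔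
  (λ S~S′ → TARSeq-trans G TS~S (TARSeq-trans G S~S′ (TARSeq-sym G TS′~S′)))
  (λ TS~TS′ → TARSeq-trans G (TARSeq-sym G TS~S) (TARSeq-trans G TS~TS′ TS′~S′))
  where
  K : Subset n
  K = SplitGraph.K G
  TS~S : TARSeq G c k (T G c (S ∩ K)) S
  TS~S = TARSeq-T G cS k≤∣S∣
  TS′~S′ : TARSeq G c k (T G c (S′ ∩ K)) S′
  TS′~S′ = TARSeq-T G cS′ k≤∣S′∣
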